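{- The Markov category $\mathbf{Stoch}$ has ranges: for every morphism $f\colon A\to B$ there is a morphism $r_f\colon A\otimes B\to A\otimes B$ such that (1) $f\triangleleft\mathrm{id}_{A\otimes B}=f\triangleleft r_f$; (2) $r_f$ is deterministic, i.e. $r_f;\delta_{A\otimes B}=\delta_{A\otimes B};(r_f\otimes r_f)$; and (3) for all suitably typed $g,h\colon A\otimes B\otimes X\to Y$, if $f\triangleleft g=f\triangleleft h$ then $(r_f\otimes\mathrm{id});g=(r_f\otimes\mathrm{id});h$.
   Context: $\mathbf{Stoch}$ is the Kleisli category of the finite distribution monad on sets: objects are sets, a morphism $f\colon X\to Y$ is a function assigning to each $x\in X$ a finitely supported probability distribution $f(-\mid x)$ on $Y$; composition (diagrammatic) is $(f;g)(z\mid x)=\sum_y g(z\mid y)f(y\mid x)$; the tensor is the cartesian product of sets with $(f\otimes g)((y,y')\mid(x,x'))=f(y\mid x)g(y'\mid x')$, unit a one-point set. $\delta_X\colon X\to X\otimes X$ is the copy map $x\mapsto$ point mass at $(x,x)$, and $\varepsilon_X\colon X\to 1$ the discard map. For $f\colon A\to B$ and $g\colon A\otimes B\otimes X\to Y$ (inputs reordered by symmetries as needed), $f\triangleleft g\colon A\otimes X\to B\otimes Y$ is: copy $A$, apply $f$ to one copy, copy the resulting $B$, and apply $g$ to $(A,B,X)$; explicitly $(f\triangleleft g)((b,y)\mid(a,x))=f(b\mid a)\,g(y\mid a,b,x)$ (when $X$ is trivial, $g=\mathrm{id}_{A\otimes B}$ gives $f\triangleleft\mathrm{id}\colon A\to B\otimes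 A\otimes B$). -}

module Defs where

open import Level using (0ℓ)
open import Data.Product using (Σ; ∃; _×_; _,_; proj₁; proj₂)
open import Data.List using (List; []; _∷_; map; foldr; concatMap)
open import Data.List.Membership.Propositional using (_∈_)
open import Data.List.Relation.Unary.Unique.Propositional using (Unique)
open import Relation.Nullary using (¬_; Dec; yes; no)
open import Relation.Binary.PropositionalEquality using (_≡_)
open import Algebra.Structures using (IsCommutativeRing)
open import Relation.Binary.Structures using (IsTotalOrder)

-- Needed because
-- point masses (identity, copy) require deciding equality of elements of
-- arbitrary sets, and supports require deciding whether a real is zero.

LEM : Set₁
LEM = (P : Set) → Dec P

record RealNumbers : Set₁ where
  infixl 6 _+_
  infixl 7 _*_
  infix 4 _≤_
  field
    ℝ : Set
    0ℝ 1ℝ : ℝ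
    _+_ _*_ : ℝ → ℝ → ℝ
    -_ : ℝ → ℝ
    _≤_ : ℝ → ℝ → Set
    isCommutativeRing : IsCommutativeRing _≡_ _+_ _*_ -_ 0ℝ 1ℝ
    0≢1 : ¬ (0ℝ ≡ 1ℝ)
    inverse : ∀ x → ¬ (x ≡ 0ℝ) → ∃ λ y → x * y ≡ 1ℝ
    isTotalOrder : IsTotalOrder _≡_ _≤_
    +-mono-≤ : ∀ x y z → x ≤ y → x + z ≤ y + z
    *-nonneg : ∀ x y → 0ℝ ≤ x → 0ℝ ≤ y → 0ℝ ≤ x * y
    complete : (S : ℝ → Set) → ∃ S → (∃ λ u → ∀ x → S x → x ≤ u) →
               ∃ λ s → (∀ x → S x → x ≤ s) × (∀ u → (∀ x → S x → x ≤ u) → s ≤ u)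

module StochDefs (lem : LEM) (ℛ : RealNumbers) where
  open RealNumbers ℛ

  sumℝ : List ℝ → ℝ
  sumℝ = foldr _+_ 0ℝ

  -- A morphism X → Y of Stoch: f(y ∣ x) = prob x y, a finitely supported
  -- probability distribution for each x.  supp x is a duplicate-free list
  -- containing every y with nonzero weight.
  record Stoch (X Y : Set) : Set where
    field
      prob        : X → Y → ℝ
      nonneg      : ∀ x y → 0ℝ ≤ prob x y
      supp        : X → List Y
      supp-unique : ∀ x → Unique (supp x)
      supp-covers : ∀ x y → ¬ (prob x y ≡ 0ℝ) → y ∈ supp x
      normalised  : ∀ x → sumℝ (map (prob x) (supp x)) ≡ 1ℝ
  open Stoch public

  Kernel : Set → Set → Set
  Kernel X Y = X → Y → ℝ

  _≋_ : ∀ {X Y} → Kernel X Y → Kernel X Y → Set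
  k ≋ k' = ∀ x y → k x y ≡ k' x y

  pt : ∀ {X : Set} → X → X → ℝ
  pt x y with lem (x ≡ y)
  ... | yes _ = 1ℝ
  ... | no  _ = 0ℝ

  idK : ∀ {X} → Kernel X X
  idK = pt

  copyK : ∀ {X} → Kernel X (X × X)
  copyK x = pt (x , x)

  copy-supp : ∀ {X : Set} → X → List (X × X)
  copy-supp x = (x , x) ∷ []

  ⊗id-supp : ∀ {X Y Z : Set} → (X → List Y) → X × Z → List (Y × Z)
  ⊗id-supp s (x , z) = map (λ y → (y , z)) (s x)

  _⊗K_ : ∀ {X X' Y Y'} → Kernel X Y → Kernel X' Y' → Kernel (X × X') (Y × Y')
  (k ⊗K k') (x , x') (y , y') = k x y * k' x' y'

  -- Kleisli composition (diagrammatic): (f ; g)(z ∣ x) = Σ_y g(z ∣ y) f(y ∣ x),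
  -- the sum running over a (duplicate-free, covering) support list of f(- ∣ x).
  compK : ∀ {X Y Z : Set} → (X → List Y) → Kernel X Y → Kernel Y Z → Kernel X Z
  compK s f g x z = sumℝ (map (λ y → g y z * f x y) (s x))

  _◁_ : ∀ {A B X Y : Set} → Stoch A B → Kernel ((A × B) × X) Y →
        Kernel (A × X) (B × Y)
  (f ◁ g) (a , x) (b , y) = prob f a b * g ((a , b) , x) y

  -- f ◁ id_{A⊗B} : A → B ⊗ (A ⊗ B)  (X trivial, identified with A itself):
  -- (f ◁ id)((b , (a' , b')) ∣ a) = f(b ∣ a) id((a' , b') ∣ (a , b))
  _◁₀_ : ∀ {A B : Set} → Stoch A B → Kernel (A × B) (A × B) →
         Kernel A (B × (A × B))
  (f ◁₀ g) a (b , w) = prob f a b * g (a , b) w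

-- The range r_f is the deterministic morphism induced by a retraction ρ of
-- A × B onto the support {(a , b) ∣ f(b ∣ a) ≠ 0}: ρ fixes the support and sends
-- (a , b) outside it to (a , b₀) for some b₀ with f(b₀ ∣ a) ≠ 0.  As a point
-- mass, r_f is deterministic; it agrees with the identity wherever f has weight,
-- which gives (1); and since it lands in the support, f ◁ g = f ◁ h lets us
-- cancel the nonzero weight f(b₀ ∣ a) and conclude g = h on the image of ρ, (3).
module Submission where

open import Defs
open import Data.Product using (Σ; _×_; _,_; proj₁; proj₂)
open import Data.List using (List; []; _∷_; map)
open import Data.List.Relation.Unary.Any using (here)
import Data.List.Relation.Unary.All as All
import Data.List.Relation.Unary.AllPairs as AllPairs
open import Data.Sum using (inj₁; inj₂)
open import Data.Empty using (⊥-elim)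
open import Relation.Nullary using (yes; no)
open import Relation.Binary.PropositionalEquality
open import Algebra.Bundles using (CommutativeRing)
open import Relation.Binary.Structures using (IsTotalOrder)
import Algebra.Properties.Ring as RingProperties
import Algebra.Properties.Group as GroupProperties

module Ranges (lem : LEM) (ℛ : RealNumbers) where
  open RealNumbers ℛ
  open StochDefs lem ℛ

  ℝ-commutativeRing : CommutativeRing _ _
  ℝ-commutativeRing = record { isCommutativeRing = isCommutativeRing }

  open CommutativeRing ℝ-commutativeRing using
    (ring; +-group; +-identityˡ; +-identityʳ; *-identityˡ; *-identityʳ;
     zeroˡ; zeroʳ; *-comm; *-assoc; -‿inverseʳ)
  open RingProperties ring using (-1*x≈-x)
  open GroupProperties +-group using (⁻¹-involutive)
  open IsTotalOrder isTotalOrder using (total) renaming (refl to ≤-refl)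

  -- Otherwise 1 ≤ 0, so 0 ≤ -1 and 0 ≤ (-1)(-1) = 1.
  0≤1 : 0ℝ ≤ 1ℝ
  0≤1 with total 0ℝ 1ℝ
  ... | inj₁ 0≤1 = 0≤1
  ... | inj₂ 1≤0 = subst (0ℝ ≤_) -1*-1≡1 (*-nonneg _ _ 0≤-1 0≤-1)
    where
    0≤-1 : 0ℝ ≤ - 1ℝ
    0≤-1 = subst₂ _≤_ (-‿inverseʳ 1ℝ) (+-identityˡ (- 1ℝ)) (+-mono-≤ 1ℝ 0ℝ (- 1ℝ) 1≤0)
    -1*-1≡1 : (- 1ℝ) * (- 1ℝ) ≡ 1ℝ
    -1*-1≡1 = trans (-1*x≈-x (- 1ℝ)) (⁻¹-involutive 1ℝ)

  *-cancelˡ-≢0 : ∀ c {x y} → c ≢ 0ℝ → c * x ≡ c * y → x ≡ y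
  *-cancelˡ-≢0 c {x} {y} c≢0 cx≡cy with inverse c c≢0
  ... | c⁻¹ , cc⁻¹≡1 = begin
    x               ≡⟨ sym (*-identityˡ x) ⟩
    1ℝ * x          ≡⟨ cong (_* x) c⁻¹c≡1 ⟨
    (c⁻¹ * c) * x   ≡⟨ *-assoc c⁻¹ c x ⟩
    c⁻¹ * (c * x)   ≡⟨ cong (c⁻¹ *_) cx≡cy ⟩
    c⁻¹ * (c * y)   ≡⟨ *-assoc c⁻¹ c y ⟨
    (c⁻¹ * c) * y   ≡⟨ cong (_* y) c⁻¹c≡1 ⟩
    1ℝ * y          ≡⟨ *-identityˡ y ⟩
    y               ∎
    where
    open ≡-Reasoning
    c⁻¹c≡1 : c⁻¹ * c ≡ 1ℝ
    c⁻¹c≡1 = trans (*-comm c⁻¹ c) cc⁻¹≡1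

  sumℝ-map-zero : ∀ {B : Set} (k : B → ℝ) (bs : List B) →
                  (∀ b → k b ≡ 0ℝ) → sumℝ (map k bs) ≡ 0ℝ
  sumℝ-map-zero k []       k≡0 = refl
  sumℝ-map-zero k (b ∷ bs) k≡0
    rewrite k≡0 b | sumℝ-map-zero k bs k≡0 = +-identityˡ 0ℝ

  pt-nonneg : ∀ {X : Set} (x y : X) → 0ℝ ≤ pt x y
  pt-nonneg x y with lem (x ≡ y)
  ... | yes _ = 0≤1
  ... | no  _ = ≤-refl

  pt-self : ∀ {X : Set} (x : X) → pt x x ≡ 1ℝ
  pt-self x with lem (x ≡ x)
  ... | yes _   = refl
  ... | no  x≢x = ⊥-elim (x≢x refl)

  pt≢0⇒≡ : ∀ {X : Set} (x y : X) → pt x y ≢ 0ℝ → x ≡ y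
  pt≢0⇒≡ x y pt≢0 with lem (x ≡ y)
  ... | yes x≡y = x≡y
  ... | no  _   = ⊥-elim (pt≢0 refl)

  pt-diagonal : ∀ {X : Set} (x u v : X) → pt (x , x) (u , v) ≡ pt x u * pt x v
  pt-diagonal x u v with lem ((x , x) ≡ (u , v)) | lem (x ≡ u) | lem (x ≡ v)
  ... | yes refl | yes _    | yes _    = sym (*-identityˡ 1ℝ)
  ... | yes refl | no  x≢x  | _        = ⊥-elim (x≢x refl)
  ... | yes refl | yes _    | no  x≢x  = ⊥-elim (x≢x refl)
  ... | no  ≢    | yes refl | yes refl = ⊥-elim (≢ refl)
  ... | no  _    | no  _    | _        = sym (zeroˡ _)
  ... | no  _    | yes _    | no  _    = sym (zeroʳ _)

  det : ∀ {X Y : Set} → (X → Y) → Stoch X Y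
  det φ = record
    { prob        = λ x → pt (φ x)
    ; nonneg      = λ x → pt-nonneg (φ x)
    ; supp        = λ x → φ x ∷ []
    ; supp-unique = λ x → All.[] AllPairs.∷ AllPairs.[]
    ; supp-covers = λ x y pt≢0 → here (sym (pt≢0⇒≡ (φ x) y pt≢0))
    ; normalised  = λ x → trans (+-identityʳ _) (pt-self (φ x))
    }

  det-comp : ∀ {X Y Z : Set} (φ : X → Y) (g : Kernel Y Z) x z →
             compK (supp (det φ)) (prob (det φ)) g x z ≡ g (φ x) z
  det-comp φ g x z rewrite pt-self (φ x) =
    trans (+-identityʳ _) (*-identityʳ (g (φ x) z))

  det⊗id-comp : ∀ {X Y W Z : Set} (φ : X → Y) (g : Kernel (Y × W) Z) x w z →
                compK (⊗id-supp (supp (det φ))) (prob (det φ) ⊗K idK) g (x , w) z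
                  ≡ g (φ x , w) z
  det⊗id-comp φ g x w z rewrite pt-self (φ x) | pt-self w | *-identityˡ 1ℝ =
    trans (+-identityʳ _) (*-identityʳ (g (φ x , w) z))

  det-deterministic : ∀ {X Y : Set} (φ : X → Y) →
    compK (supp (det φ)) (prob (det φ)) copyK
      ≋ compK copy-supp copyK (prob (det φ) ⊗K prob (det φ))
  det-deterministic φ x (u , v) = begin
    compK (supp (det φ)) (prob (det φ)) copyK x (u , v)  ≡⟨ det-comp φ copyK x (u , v) ⟩
    pt (φ x , φ x) (u , v)                               ≡⟨ pt-diagonal (φ x) u v ⟩
    pt (φ x) u * pt (φ x) v                              ≡⟨ det-comp (λ x → x , x) (prob (det φ) ⊗K prob (det φ)) x (u , v) ⟨
    compK copy-supp copyK (prob (det φ) ⊗K prob (det φ)) x (u , v) ∎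
    where open ≡-Reasoning

  module _ {A B : Set} (f : Stoch A B) where

    -- A distribution cannot vanish everywhere: its weights sum to 1 ≠ 0.
    weighted-point : (a : A) → Σ B λ b → prob f a b ≢ 0ℝ
    weighted-point a with lem (Σ B λ b → prob f a b ≢ 0ℝ)
    ... | yes b = b
    ... | no ∄b = ⊥-elim (0≢1 (trans (sym (sumℝ-map-zero (prob f a) (supp f a) vanishes))
                                     (normalised f a)))
      where
      vanishes : ∀ b → prob f a b ≡ 0ℝ
      vanishes b with lem (prob f a b ≡ 0ℝ)
      ... | yes fab≡0 = fab≡0
      ... | no  fab≢0 = ⊥-elim (∄b (b , fab≢0))

    ρ : A × B → A × B
    ρ (a , b) with lem (prob f a b ≡ 0ℝ)
    ... | yes _ = a , proj₁ (weighted-point a)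
    ... | no  _ = a , b

    ρ-weighted : ∀ a b → Σ B λ b' → ρ (a , b) ≡ (a , b') × prob f a b' ≢ 0ℝ
    ρ-weighted a b with lem (prob f a b ≡ 0ℝ)
    ... | yes _     = proj₁ (weighted-point a) , refl , proj₂ (weighted-point a)
    ... | no  fab≢0 = b , refl , fab≢0

    range : Stoch (A × B) (A × B)
    range = det ρ

    ◁₀-range : (f ◁₀ idK) ≋ (f ◁₀ prob range)
    ◁₀-range a (b , w) with lem (prob f a b ≡ 0ℝ)
    ... | yes fab≡0 rewrite fab≡0 = trans (zeroˡ _) (sym (zeroˡ _))
    ... | no  _     = refl

    range-cancels : (X Y : Set) (g h : Stoch ((A × B) × X) Y) →
      (f ◁ prob g) ≋ (f ◁ prob h) →
      compK (⊗id-supp (supp range)) (prob range ⊗K idK) (prob g)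
        ≋ compK (⊗id-supp (supp range)) (prob range ⊗K idK) (prob h)
    range-cancels X Y g h f◁g≋f◁h ((a , b) , x) y
      rewrite det⊗id-comp ρ (prob g) (a , b) x y | det⊗id-comp ρ (prob h) (a , b) x y
      with ρ-weighted a b
    ... | b' , ρab≡ab' , fab'≢0 rewrite ρab≡ab' =
      *-cancelˡ-≢0 (prob f a b') fab'≢0 (f◁g≋f◁h (a , x) (b' , y))

proposition9p9 : (lem : LEM) (ℛ : RealNumbers) →
    let open StochDefs lem ℛ in
    {A B : Set} (f : Stoch A B) →
    Σ (Stoch (A × B) (A × B)) λ r →
      ((f ◁₀ idK) ≋ (f ◁₀ prob r))
      × (compK (supp r) (prob r) copyK
          ≋ compK copy-supp copyK (prob r ⊗K prob r))
      × ((X Y : Set) (g h : Stoch ((A × B) × X) Y) →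
          (f ◁ prob g) ≋ (f ◁ prob h) →
          compK (⊗id-supp (supp r)) (prob r ⊗K idK) (prob g)
            ≋ compK (⊗id-supp (supp r)) (prob r ⊗K idK) (prob h))
proposition9p9 lem ℛ f =
  range f , ◁₀-range f , det-deterministic (ρ f) , range-cancels f
  where open Ranges lem ℛ
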